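{- No deterministic constant-approximate submodular objective chasing algorithm has $o(\max_t|E_t|)$-competitive recourse, even for a fixed coverage function $f$ (i.e., $f_t=f$ for all $t$) and a cardinality constraint of $k=1$.
   Context: Submodular objectives chasing problem with cardinality constraint $k$: at each time $t=1,\dots,T$, a set $E_t$ of available elements, a non-negative monotone submodular function $f_t\colon 2^{E_t}\to\mathbb{R}_+$, and a value $V_t\le OPT_t\triangleq\max\{f_t(S)\mid S\subseteq E_t,\ |S|\le k\}$ are revealed, and the online algorithm must output, before time $t+1$, a set $S_t\subseteq E_t$ with $|S_t|\le k$. It is $\alpha$-approximate if $\mathbb{E}[f_t(S_t)]\ge\alpha V_t$ for all $t$ (for deterministic algorithms, $f_t(S_t)\ge\alpha V_t$). Its recourse is $\sum_t|S_t\oplus S_{t-1}|$ with $S_0=\emptyset$, and it has $c$-competitive recourse if its recourse is at most $c\cdot OPT_R$, where $OPT_R$ is the minimum of $\sum_t|S_t\oplus S_{t-1}|$ over offline sequences $S_0=\emptyset$, $S_t\subseteq E_t$, $|S_t|\le k$, $f_t(S_t)\ge V_t$. A coverage function is one of the form $f(S)=w(\bigcup_{i\in S}A_i)$ for sets $A_i$ in a universe with non-negative weights $w$. -}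

module Defs where

open import Data.Nat using (ℕ; zero; suc; _+_; _*_; _≤_; _⊔_)
open import Data.Nat.Properties using (_≟_)
open import Data.Rational using (ℚ; 0ℚ) renaming (_+_ to _+ℚ_; _*_ to _*ℚ_; _≤_ to _≤ℚ_)
open import Data.List using (List; []; _∷_; [_]; length; map; filter; foldr; concatMap; deduplicate; _++_)
open import Data.List.Membership.Propositional using (_∈_)
open import Data.List.Membership.DecPropositional _≟_ using (_∈?_; _∉?_)
open import Data.List.Relation.Unary.All using (All)
open import Data.List.Relation.Unary.Unique.Propositional using (Unique)
open import Data.List.Relation.Binary.Pointwise using (Pointwise)
open import Data.Product using (Σ; _×_; ∃-syntax)

-- Ground elements and universe items are natural numbers.
-- A coverage function f(S) = w(⋃_{i∈S} A_i) with non-negative rational weights.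
record Coverage : Set where
  field
    cset      : ℕ → List ℕ
    weight    : ℕ → ℚ
    weight≥0  : ∀ u → 0ℚ ≤ℚ weight u
open Coverage public

sumℚ : List ℚ → ℚ
sumℚ = foldr _+ℚ_ 0ℚ

cov : Coverage → List ℕ → ℚ
cov f S = sumℚ (map (weight f) (deduplicate _≟_ (concatMap (cset f) S)))

-- data revealed at one time step (f_t = f is fixed and global)
record Step : Set where
  constructor step
  field
    E : List ℕ
    V : ℚ
open Step public

Feasible : ℕ → List ℕ → List ℕ → Set
Feasible k E S = Unique S × All (_∈ E) S × length S ≤ k

-- a valid step: E_t is a set and V_t ≤ OPT_t = max{ f(S) | S ⊆ E_t, |S| ≤ k }
ValidStep : Coverage → ℕ → Step → Set
ValidStep f k s = Unique (E s) × ∃[ S ] (Feasible k (E s) S × V s ≤ℚ cov f S)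

ValidInstance : Coverage → ℕ → List Step → Set
ValidInstance f k = All (ValidStep f k)

maxSize : List Step → ℕ
maxSize = foldr (λ s m → length (E s) ⊔ m) 0

-- |A ⊕ B| for duplicate-free lists
symDiff : List ℕ → List ℕ → ℕ
symDiff A B = length (filter (_∉? B) A) + length (filter (_∉? A) B)

recourseFrom : List ℕ → List (List ℕ) → ℕ
recourseFrom prev [] = 0
recourseFrom prev (S ∷ Ss) = symDiff prev S + recourseFrom S Ss

recourse : List (List ℕ) → ℕ
recourse = recourseFrom []

-- A deterministic online algorithm: given the (fixed) function f and the
-- history of revealed steps 1..t (ending with the current one), output S_t.
Algorithm : Set
Algorithm = Coverage → List Step → List ℕ

prefixes : {A : Set} → List A → List (List A)
prefixes [] = []
prefixes (x ∷ xs) = [ x ] ∷ map (x ∷_) (prefixes xs)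

outputs : Algorithm → Coverage → List Step → List (List ℕ)
outputs alg f steps = map (alg f) (prefixes steps)

OutputsFeasible : ℕ → Algorithm → Set
OutputsFeasible k alg = ∀ (f : Coverage) (hist : List Step) (s : Step) →
  ValidInstance f k (hist ++ [ s ]) → Feasible k (E s) (alg f (hist ++ [ s ]))

Approximate : ℕ → ℚ → Algorithm → Set
Approximate k α alg = ∀ (f : Coverage) (hist : List Step) (s : Step) →
  ValidInstance f k (hist ++ [ s ]) → α *ℚ V s ≤ℚ cov f (alg f (hist ++ [ s ]))

OfflineFeasible : Coverage → ℕ → List Step → List (List ℕ) → Set
OfflineFeasible f k steps off =
  Pointwise (λ s S → Feasible k (E s) S × V s ≤ℚ cov f S) steps off

-- Take f(S) = |S| and V_t = 1.  An algorithm with a positive approximation ratio must then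
-- output a single available element, and the adversary deletes exactly that element from the
-- next ground set.  Starting from n elements this runs for n steps, each output differing
-- from the previous one, so the algorithm pays recourse at least n = max_t |E_t|; but the
-- element output last was available throughout, and the offline sequence keeping it pays 1.
module Submission where

open import Defs
open import Data.Nat using (ℕ; _*_; _≤_; _<_)
open import Data.Rational using (ℚ; 0ℚ) renaming (_<_ to _<ℚ_)
open import Data.Product using (_×_; ∃-syntax)

open import Data.Nat using (zero; suc; _+_; z≤n; s≤s)
open import Data.Nat.Properties
  using (_≟_; m≤n+m; ≤-trans; ≤-reflexive; ⊔-identityʳ; m≥n⇒m⊔n≡m; +-identityʳ; +-mono-≤; n≤1+n; suc-injective;
         *-comm; *-monoˡ-<; *-monoʳ-≤; module ≤-Reasoning)
open import Data.Rational using (1ℚ) renaming (_≤_ to _≤ℚ_)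
import Data.Rational.Properties as ℚ
open import Data.List using (List; []; _∷_; [_]; length; map; filter; _++_; upTo)
open import Data.List.Properties
  using (filter-accept; filter-reject; filter-all; length-filter; length-upTo; map-∘; map-cong; ++-assoc)
open import Data.List.Membership.Propositional using (_∈_; _∉_)
open import Data.List.Membership.Propositional.Properties using (∈-filter⁻)
open import Data.List.Membership.DecPropositional _≟_ using (_∉?_)
open import Data.List.Relation.Unary.All using (All; []; _∷_; lookup)
import Data.List.Relation.Unary.All as All
open import Data.List.Relation.Unary.All.Properties using (++⁺)
open import Data.List.Relation.Unary.Any using (here; there)
open import Data.List.Relation.Unary.Any.Properties using (singleton⁻)
open import Data.List.Relation.Unary.Unique.Propositional using (Unique; []; _∷_)
open import Data.List.Relation.Unary.Unique.Propositional.Properties using (filter⁺; upTo⁺)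
open import Data.List.Relation.Binary.Disjoint.Propositional using (Disjoint)
open import Data.List.Relation.Binary.Pointwise using ([]; _∷_)
open import Data.Product using (_,_; proj₁; proj₂)
open import Data.Empty using (⊥-elim)
open import Relation.Binary.PropositionalEquality using (_≡_; refl; sym; trans; cong; cong₂; subst)
open import Function using (_∘_)

-- f(S) = |S| is the coverage function of the singletons {i} with unit weights.
unitCoverage : Coverage
unitCoverage = record { cset = [_] ; weight = λ _ → 1ℚ ; weight≥0 = λ _ → ℚ.nonNegative⁻¹ 1ℚ }

cov-unitCoverage-singleton : ∀ x → cov unitCoverage [ x ] ≡ 1ℚ
cov-unitCoverage-singleton x = ℚ.+-identityʳ 1ℚ

singleton-feasible : ∀ {A x} → x ∈ A → Feasible 1 A [ x ]
singleton-feasible x∈A = [] ∷ [] , x∈A ∷ [] , s≤s z≤n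

feasible₁-positive⇒singleton : ∀ f {A S} → Feasible 1 A S → 0ℚ <ℚ cov f S →
                               ∃[ x ] (S ≡ [ x ] × x ∈ A)
feasible₁-positive⇒singleton f {S = []}        _                    0<0 = ⊥-elim (ℚ.<-irrefl refl 0<0)
feasible₁-positive⇒singleton f {S = x ∷ []}    (_ , x∈A ∷ [] , _)   _   = x , refl , x∈A
feasible₁-positive⇒singleton f {S = _ ∷ _ ∷ _} (_ , _ , s≤s ())     _

_∖_ : List ℕ → List ℕ → List ℕ
A ∖ S = filter (_∉? S) A

∈-∖⁻ : ∀ {x} A S → x ∈ A ∖ S → x ∈ A × x ∉ S
∈-∖⁻ A S = ∈-filter⁻ (_∉? S) {xs = A}

∖-disjoint : ∀ A S → Disjoint S (A ∖ S)
∖-disjoint A S (x∈S , x∈A∖S) = proj₂ (∈-∖⁻ A S x∈A∖S) x∈S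

length-∖-singleton : ∀ x {A} → Unique A → x ∈ A → suc (length (A ∖ [ x ])) ≡ length A
length-∖-singleton x {y ∷ ys} (y≢ys ∷ _) (here refl) =
  cong (suc ∘ length) (trans (filter-reject (_∉? [ x ]) (λ x∉x → x∉x (here refl)))
                             (filter-all (_∉? [ x ]) (All.map (λ x≢y y∈[x] → x≢y (sym (singleton⁻ y∈[x]))) y≢ys)))
length-∖-singleton x {y ∷ ys} (y≢ys ∷ uys) (there x∈ys) =
  trans (cong (suc ∘ length) (filter-accept (_∉? [ x ]) y∉[x]))
        (cong suc (length-∖-singleton x uys x∈ys))
  where
  y∉[x] : y ∉ [ x ]
  y∉[x] (here refl) = lookup y≢ys x∈ys refl

1≤symDiff-singleton : ∀ x {A} → x ∉ A → 1 ≤ symDiff A [ x ]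
1≤symDiff-singleton x {A} x∉A rewrite filter-accept (_∉? A) {xs = []} x∉A = m≤n+m 1 (length (A ∖ [ x ]))

symDiff-[]-singleton : ∀ x → symDiff [] [ x ] ≡ 1
symDiff-[]-singleton x rewrite filter-accept (_∉? []) {x = x} {xs = []} (λ ()) = refl

symDiff-singleton-self : ∀ x → symDiff [ x ] [ x ] ≡ 0
symDiff-singleton-self x rewrite filter-reject (_∉? [ x ]) {xs = []} (λ x∉x → x∉x (here refl)) = refl

recourseFrom-singleton-constant : ∀ {B : Set} x (ys : List B) → recourseFrom [ x ] (map (λ _ → [ x ]) ys) ≡ 0
recourseFrom-singleton-constant x []       = refl
recourseFrom-singleton-constant x (_ ∷ ys) rewrite symDiff-singleton-self x = recourseFrom-singleton-constant x ys

recourse-constant : ∀ {B : Set} x (ys : List B) → 0 < length ys → recourse (map (λ _ → [ x ]) ys) ≡ 1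
recourse-constant x (_ ∷ ys) _ rewrite symDiff-[]-singleton x | recourseFrom-singleton-constant x ys = refl

constant-offlineFeasible : ∀ f z steps → All (λ s → z ∈ E s × V s ≤ℚ cov f [ z ]) steps →
                           OfflineFeasible f 1 steps (map (λ _ → [ z ]) steps)
constant-offlineFeasible f z []          []                 = []
constant-offlineFeasible f z (_ ∷ steps) ((z∈ , V≤) ∷ rest) =
  (singleton-feasible z∈ , V≤) ∷ constant-offlineFeasible f z steps rest

outputsAfter : Algorithm → Coverage → List Step → List Step → List (List ℕ)
outputsAfter alg f h L = map (λ p → alg f (h ++ p)) (prefixes L)

outputsAfter-∷ : ∀ alg f h s L →
                 outputsAfter alg f h (s ∷ L) ≡ alg f (h ++ [ s ]) ∷ outputsAfter alg f (h ++ [ s ]) L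
outputsAfter-∷ alg f h s L = cong (alg f (h ++ [ s ]) ∷_)
  (trans (sym (map-∘ (prefixes L)))
         (map-cong (λ p → cong (alg f) (sym (++-assoc h [ s ] p))) (prefixes L)))

recourseFrom-outputsAfter-∷ : ∀ alg f h s L {prev S} → alg f (h ++ [ s ]) ≡ S →
  recourseFrom prev (outputsAfter alg f h (s ∷ L)) ≡ symDiff prev S + recourseFrom S (outputsAfter alg f (h ++ [ s ]) L)
recourseFrom-outputsAfter-∷ alg f h s L {prev} refl = cong (recourseFrom prev) (outputsAfter-∷ alg f h s L)

unitStep : List ℕ → Step
unitStep A = step A 1ℚ

survives-unitStep : ∀ {A z} → z ∈ A → z ∈ E (unitStep A) × V (unitStep A) ≤ℚ cov unitCoverage [ z ]
survives-unitStep {z = z} z∈A = z∈A , ℚ.≤-reflexive (sym (cov-unitCoverage-singleton z))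

unitStep-valid : ∀ {A x} → Unique A → x ∈ A → ValidStep unitCoverage 1 (unitStep A)
unitStep-valid uA x∈A = uA , _ , singleton-feasible x∈A , proj₂ (survives-unitStep x∈A)

snoc-unitStep-valid : ∀ {h A k} → ValidInstance unitCoverage 1 h → Unique A → length A ≡ suc k →
                      ValidInstance unitCoverage 1 (h ++ [ unitStep A ])
snoc-unitStep-valid {A = _ ∷ _} validH uA _ = ++⁺ validH (unitStep-valid uA (here refl) ∷ [])

adversary : Algorithm → ℕ → List Step → List ℕ → List Step
adversary alg zero    h A = []
adversary alg (suc n) h A =
  unitStep A ∷ adversary alg n (h ++ [ unitStep A ]) (A ∖ alg unitCoverage (h ++ [ unitStep A ]))

record AdversaryRun (alg : Algorithm) (h : List Step) (prev A : List ℕ) (L : List Step) : Set where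
  field
    valid             : ValidInstance unitCoverage 1 L
    survivor          : ℕ
    survivor∈         : survivor ∈ A
    survivor-feasible : All (λ s → survivor ∈ E s × V s ≤ℚ cov unitCoverage [ survivor ]) L
    length≤recourse   : length A ≤ recourseFrom prev (outputsAfter alg unitCoverage h L)
    maxSize≡length    : maxSize L ≡ length A

module _ {α : ℚ} (α>0 : 0ℚ <ℚ α) {alg : Algorithm}
         (feasible : OutputsFeasible 1 alg) (approximate : Approximate 1 α alg) where

  output-singleton : ∀ h A → ValidInstance unitCoverage 1 (h ++ [ unitStep A ]) →
                     ∃[ x ] (alg unitCoverage (h ++ [ unitStep A ]) ≡ [ x ] × x ∈ A)
  output-singleton h A valid =
    feasible₁-positive⇒singleton unitCoverage (feasible unitCoverage h (unitStep A) valid)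
      (ℚ.<-≤-trans α>0 (subst (_≤ℚ _) (ℚ.*-identityʳ α) (approximate unitCoverage h (unitStep A) valid)))

  module _ {h A prev} (uA : Unique A) (prev#A : Disjoint prev A)
           {x} (x∈A : x ∈ A) (output≡ : alg unitCoverage (h ++ [ unitStep A ]) ≡ [ x ]) where

    private
      validStep : ValidStep unitCoverage 1 (unitStep A)
      validStep = unitStep-valid uA x∈A

      1≤firstRecourse : 1 ≤ symDiff prev [ x ]
      1≤firstRecourse = 1≤symDiff-singleton x (λ x∈prev → prev#A (x∈prev , x∈A))

    adversaryRun-[] : length A ≡ 1 → AdversaryRun alg h prev A (unitStep A ∷ [])
    adversaryRun-[] |A|≡1 = record
      { valid             = validStep ∷ []
      ; survivor          = x
      ; survivor∈         = x∈A
      ; survivor-feasible = survives-unitStep x∈A ∷ []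
      ; length≤recourse   = begin
          length A                              ≡⟨ |A|≡1 ⟩
          1                                     ≤⟨ 1≤firstRecourse ⟩
          symDiff prev [ x ]                    ≡⟨ +-identityʳ _ ⟨
          symDiff prev [ x ] + 0                ≡⟨ recourseFrom-outputsAfter-∷ alg unitCoverage h (unitStep A) [] output≡ ⟨
          recourseFrom prev (outputsAfter alg unitCoverage h (unitStep A ∷ [])) ∎
      ; maxSize≡length    = ⊔-identityʳ (length A)
      }
      where open ≤-Reasoning

    adversaryRun-∷ : ∀ {L} → AdversaryRun alg (h ++ [ unitStep A ]) [ x ] (A ∖ [ x ]) L →
                     AdversaryRun alg h prev A (unitStep A ∷ L)
    adversaryRun-∷ {L} run = record
      { valid             = validStep ∷ valid
      ; survivor          = survivor
      ; survivor∈         = survivor∈A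
      ; survivor-feasible = survives-unitStep survivor∈A ∷ survivor-feasible
      ; length≤recourse   = begin
          length A                                        ≡⟨ length-∖-singleton x uA x∈A ⟨
          1 + length (A ∖ [ x ])                          ≤⟨ +-mono-≤ 1≤firstRecourse length≤recourse ⟩
          symDiff prev [ x ] + recourseFrom [ x ] (outputsAfter alg unitCoverage (h ++ [ unitStep A ]) L)
            ≡⟨ recourseFrom-outputsAfter-∷ alg unitCoverage h (unitStep A) L output≡ ⟨
          recourseFrom prev (outputsAfter alg unitCoverage h (unitStep A ∷ L)) ∎
      ; maxSize≡length    = m≥n⇒m⊔n≡m (≤-trans (≤-reflexive maxSize≡length) (length-filter (_∉? [ x ]) A))
      }
      where
      open AdversaryRun run
      open ≤-Reasoning

      survivor∈A : survivor ∈ A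
      survivor∈A = proj₁ (∈-∖⁻ A [ x ] survivor∈)

  adversary-run : ∀ k h A prev → length A ≡ suc k → Unique A → Disjoint prev A →
                  ValidInstance unitCoverage 1 h → AdversaryRun alg h prev A (adversary alg (suc k) h A)
  adversary-run k h A prev |A| uA prev#A validH
    with output-singleton h A (snoc-unitStep-valid validH uA |A|)
  adversary-run zero    h A prev |A| uA prev#A validH | x , output≡ , x∈A =
    adversaryRun-[] uA prev#A x∈A output≡ |A|
  adversary-run (suc k) h A prev |A| uA prev#A validH | x , output≡ , x∈A rewrite output≡ =
    adversaryRun-∷ uA prev#A x∈A output≡
      (adversary-run k (h ++ [ unitStep A ]) (A ∖ [ x ]) [ x ]
        (suc-injective (trans (length-∖-singleton x uA x∈A) |A|))
        (filter⁺ (_∉? [ x ]) uA)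
        (∖-disjoint A [ x ])
        (snoc-unitStep-valid validH uA |A|))

mainTheorem7 : (α : ℚ) → 0ℚ <ℚ α → (alg : Algorithm) →
    OutputsFeasible 1 alg → Approximate 1 α alg →
    ∃[ d ] (1 ≤ d × ((N : ℕ) → ∃[ f ] ∃[ steps ]
    (ValidInstance f 1 steps × N ≤ maxSize steps ×
    ∃[ off ] (OfflineFeasible f 1 steps off ×
    maxSize steps * recourse off < d * recourse (outputs alg f steps)))))
mainTheorem7 α α>0 alg feasible approximate = 2 , s≤s z≤n , λ N →
  let A     = upTo (suc N)
      |A|   = length-upTo (suc N)
      steps = adversary alg (suc N) [] A
      open AdversaryRun (adversary-run α>0 {alg} feasible approximate N [] A [] |A| (upTo⁺ (suc N)) (λ ()) [])
      maxSize≡ : maxSize steps ≡ suc N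
      maxSize≡ = trans maxSize≡length |A|
      R = recourse (outputs alg unitCoverage steps)
      suc-N≤R : suc N ≤ R
      suc-N≤R = subst (_≤ R) |A| length≤recourse
  in unitCoverage , steps , valid , ≤-trans (n≤1+n N) (≤-reflexive (sym maxSize≡)) ,
     map (λ _ → [ survivor ]) steps , constant-offlineFeasible unitCoverage survivor steps survivor-feasible ,
     (begin-strict
       maxSize steps * recourse (map (λ _ → [ survivor ]) steps)
         ≡⟨ cong₂ _*_ maxSize≡ (recourse-constant survivor steps (s≤s z≤n)) ⟩
       suc N * 1                                             ≡⟨ *-comm (suc N) 1 ⟩
       1 * suc N                                             <⟨ *-monoˡ-< (suc N) {1} {2} (s≤s (s≤s z≤n)) ⟩
       2 * suc N                                             ≤⟨ *-monoʳ-≤ 2 suc-N≤R ⟩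
       2 * R                                                 ∎)
  where open ≤-Reasoning
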